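{- Let $a,b$ be two distinct letters, $(s_k)_{k\ge1}$ a sequence of positive integers, and $m_k$, $m_\varphi$ as in the context. Consider the words $(m_k^t m_{k-1})'$ for integers $k\ge1$ and $1\le t\le s_{k+1}$, with the index pairs $(k,t)$ ordered lexicographically. This sequence of words is an increasing sequence (each word being a prefix of the next) of prefixes of $m_\varphi$, and each of these words is a palindrome.
   Context: Define words on the alphabet $\{a,b\}$ by $m_0=b$, $m_1=b^{s_1-1}a$, and $m_{k+1}=m_k^{s_{k+1}}m_{k-1}$ for $k\ge1$; $m_\varphi=\lim_k m_k$ is the infinite word of which every $m_k$ is a prefix. For a word $u$ with at least two letters, $u'$ denotes $u$ deprived of its last two letters. A palindrome is a word equal to its mirror image; by convention the empty word is a palindrome. -}

module Defs where

open import Data.Nat using (ℕ; zero; suc; _∸_)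
open import Data.List using (List; []; _∷_; _++_; concat; replicate; length; take; reverse)
open import Data.Fin using (Fin; toℕ)
open import Data.List using (lookup)
open import Data.Product using (∃)
open import Relation.Binary.PropositionalEquality using (_≡_)

module Sturm {A : Set} (a b : A) (s : ℕ → ℕ) where

  pow : List A → ℕ → List A
  pow u t = concat (replicate t u)

  -- m k  =  m_k  (s k plays the role of s_k; s 0 is never used)
  m : ℕ → List A
  m zero = b ∷ []
  m (suc zero) = pow (b ∷ []) (s 1 ∸ 1) ++ (a ∷ [])
  m (suc (suc k)) = pow (m (suc k)) (s (suc (suc k))) ++ m k

  nth : List A → ℕ → A
  nth [] n = b
  nth (x ∷ u) zero = x
  nth (x ∷ u) (suc n) = nth u n

  -- m_φ as an infinite word: its n-th letter is the n-th letter of m_{n+1}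
  -- (|m_{n+1}| ≥ n+1 when all s_k ≥ 1, so the default is never used)
  mφ : ℕ → A
  mφ n = nth (m (suc n)) n

_′ : {A : Set} → List A → List A
u ′ = take (length u ∸ 2) u

Prefix : {A : Set} → List A → List A → Set
Prefix u v = ∃ λ w → u ++ w ≡ v

PrefixInf : {A : Set} → List A → (ℕ → A) → Set
PrefixInf u w = (i : Fin (length u)) → lookup u i ≡ w (toℕ i)

Palindrome : {A : Set} → List A → Set
Palindrome u = reverse u ≡ u

{-# OPTIONS --safe #-}

-- Let C_k = (m_{k+1} m_k)′, so that C_0 = b^(s_1 - 1) and C_{k+1} = m_{k+1}^(s_{k+2}) C_k.
-- By induction on k, C_k is a palindrome, m_{k+1} m_k = C_k x y and m_k m_{k+1} = C_k y x
-- for two letters x, y, and both m_k C_k and m_{k+1} C_k are palindromes, i.e. moving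
-- m_k or m_{k+1} across C_k reverses it.  Hence (m_{k+1}^(t+1) m_k)′ = m_{k+1}^t C_k is a
-- palindrome; appending the mirror image of m_{k+1} gives the next word, and so on up to
-- m_{k+1}^(s_{k+2}) C_k = C_{k+1} = (m_{k+2} m_{k+1})′, a prefix of m_{k+3} and hence of m_φ.

module Submission where

open import Defs
open import Data.Nat using (ℕ; zero; suc; _≤_; _<_; _≤′_; _∸_; _+_; z≤n; s≤s; ≤′-refl; ≤′-step)
open import Data.Nat.Properties using (m≤m+n; m≤n+m; m+n∸n≡m; ≤-refl; ≤-trans; <⇒≤; ≤⇒≤′; +-comm; +-mono-≤; +-monoʳ-≤)
open import Data.List using (List; []; _∷_; _∷ʳ_; _++_; concat; replicate; length; take; reverse; lookup)
open import Data.List.Properties using (++-assoc; ++-identityʳ; reverse-++; length-++)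
open import Data.Fin using (Fin; toℕ) renaming (zero to fzero; suc to fsuc)
open import Data.Fin.Properties using (toℕ<n)
open import Data.Product using (_×_; _,_)
open import Relation.Binary.PropositionalEquality
open ≡-Reasoning

module Words {A : Set} where

  infix 8 _^_

  _^_ : List A → ℕ → List A
  u ^ n = concat (replicate n u)

  ^-conj : ∀ {u c v} → u ++ c ≡ c ++ v → ∀ n → u ^ n ++ c ≡ c ++ v ^ n
  ^-conj {c = c} uc≡cv zero = sym (++-identityʳ c)
  ^-conj {u} {c} {v} uc≡cv (suc n) = begin
    (u ++ u ^ n) ++ c   ≡⟨ ++-assoc u (u ^ n) c ⟩
    u ++ (u ^ n ++ c)   ≡⟨ cong (u ++_) (^-conj uc≡cv n) ⟩
    u ++ (c ++ v ^ n)   ≡⟨ ++-assoc u c (v ^ n) ⟨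
    (u ++ c) ++ v ^ n   ≡⟨ cong (_++ v ^ n) uc≡cv ⟩
    (c ++ v) ++ v ^ n   ≡⟨ ++-assoc c v (v ^ n) ⟩
    c ++ (v ++ v ^ n)   ∎

  ^-comm : ∀ u n → u ^ n ++ u ≡ u ++ u ^ n
  ^-comm u = ^-conj refl

  ^-suc-++ : ∀ u n v → u ^ suc n ++ v ≡ u ^ n ++ (u ++ v)
  ^-suc-++ u n v = begin
    (u ++ u ^ n) ++ v   ≡⟨ cong (_++ v) (^-comm u n) ⟨
    (u ^ n ++ u) ++ v   ≡⟨ ++-assoc (u ^ n) u v ⟩
    u ^ n ++ (u ++ v)   ∎

  reverse-^ : ∀ u n → reverse (u ^ n) ≡ reverse u ^ n
  reverse-^ u zero = refl
  reverse-^ u (suc n) = begin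
    reverse (u ++ u ^ n)             ≡⟨ reverse-++ u (u ^ n) ⟩
    reverse (u ^ n) ++ reverse u     ≡⟨ cong (_++ reverse u) (reverse-^ u n) ⟩
    reverse u ^ n ++ reverse u       ≡⟨ ^-comm (reverse u) n ⟩
    reverse u ++ reverse u ^ n       ∎

  -- For a palindrome c, Mirrors c u says exactly that u ++ c is a palindrome.
  record Mirrors (c u : List A) : Set where
    constructor mirrors
    field
      slide : u ++ c ≡ c ++ reverse u

  Mirrors-^ : ∀ {c u} → Mirrors c u → ∀ n → Mirrors c (u ^ n)
  Mirrors-^ {c} {u} (mirrors slide) n = mirrors (begin
    u ^ n ++ c            ≡⟨ ^-conj slide n ⟩
    c ++ reverse u ^ n    ≡⟨ cong (c ++_) (reverse-^ u n) ⟨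
    c ++ reverse (u ^ n)  ∎)

  Mirrors-++ : ∀ {c p v} → Mirrors c p → Mirrors c v → Mirrors (p ++ c) (p ++ v)
  Mirrors-++ {c} {p} {v} (mirrors p-slide) (mirrors v-slide) = mirrors (begin
    (p ++ v) ++ (p ++ c)                 ≡⟨ ++-assoc p v (p ++ c) ⟩
    p ++ (v ++ (p ++ c))                 ≡⟨ cong (λ z → p ++ (v ++ z)) p-slide ⟩
    p ++ (v ++ (c ++ reverse p))         ≡⟨ cong (p ++_) (++-assoc v c (reverse p)) ⟨
    p ++ ((v ++ c) ++ reverse p)         ≡⟨ cong (λ z → p ++ (z ++ reverse p)) v-slide ⟩
    p ++ ((c ++ reverse v) ++ reverse p) ≡⟨ cong (p ++_) (++-assoc c (reverse v) (reverse p)) ⟩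
    p ++ (c ++ (reverse v ++ reverse p)) ≡⟨ ++-assoc p c _ ⟨
    (p ++ c) ++ (reverse v ++ reverse p) ≡⟨ cong ((p ++ c) ++_) (reverse-++ p v) ⟨
    (p ++ c) ++ reverse (p ++ v)         ∎)

  Mirrors-^++ : ∀ {c u} → Mirrors c u → ∀ n → Mirrors (u ^ n ++ c) u
  Mirrors-^++ {c} {u} (mirrors slide) n = mirrors (begin
    u ++ (u ^ n ++ c)          ≡⟨ ++-assoc u (u ^ n) c ⟨
    u ^ suc n ++ c             ≡⟨ ^-suc-++ u n c ⟩
    u ^ n ++ (u ++ c)          ≡⟨ cong (u ^ n ++_) slide ⟩
    u ^ n ++ (c ++ reverse u)  ≡⟨ ++-assoc (u ^ n) c (reverse u) ⟨
    (u ^ n ++ c) ++ reverse u  ∎)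

  Mirrors-∷ʳ : ∀ {c} → Palindrome c → ∀ x → Mirrors c (c ∷ʳ x)
  Mirrors-∷ʳ {c} palindrome x = mirrors (begin
    (c ∷ʳ x) ++ c          ≡⟨ ++-assoc c (x ∷ []) c ⟩
    c ++ x ∷ c             ≡⟨ cong (λ z → c ++ x ∷ z) palindrome ⟨
    c ++ x ∷ reverse c     ≡⟨ cong (c ++_) (reverse-++ c (x ∷ [])) ⟨
    c ++ reverse (c ∷ʳ x)  ∎)

  palindrome-++ : ∀ {c u} → Palindrome c → Mirrors c u → Palindrome (u ++ c)
  palindrome-++ {c} {u} palindrome (mirrors slide) = begin
    reverse (u ++ c)       ≡⟨ reverse-++ u c ⟩
    reverse c ++ reverse u ≡⟨ cong (_++ reverse u) palindrome ⟩
    c ++ reverse u         ≡⟨ slide ⟨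
    u ++ c                 ∎

  take-length-++ : ∀ (u v : List A) → take (length u) (u ++ v) ≡ u
  take-length-++ [] v = refl
  take-length-++ (x ∷ u) v = cong (x ∷_) (take-length-++ u v)

  ′-++-two : ∀ (u : List A) (x y : A) → (u ++ x ∷ y ∷ []) ′ ≡ u
  ′-++-two u x y = begin
    take (length (u ++ x ∷ y ∷ []) ∸ 2) (u ++ x ∷ y ∷ [])
      ≡⟨ cong (λ n → take (n ∸ 2) (u ++ x ∷ y ∷ [])) (length-++ u) ⟩
    take (length u + 2 ∸ 2) (u ++ x ∷ y ∷ [])
      ≡⟨ cong (λ n → take n (u ++ x ∷ y ∷ [])) (m+n∸n≡m (length u) 2) ⟩
    take (length u) (u ++ x ∷ y ∷ [])
      ≡⟨ take-length-++ u _ ⟩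
    u ∎

  prefix-trans : ∀ {u v w : List A} → Prefix u v → Prefix v w → Prefix u w
  prefix-trans {u} (r , refl) (r′ , refl) = r ++ r′ , sym (++-assoc u r r′)

  prefix-length : ∀ {u v : List A} → Prefix u v → length u ≤ length v
  prefix-length {u} (r , refl) = subst (length u ≤_) (sym (length-++ u)) (m≤m+n (length u) (length r))

  length-^++ : ∀ {n} (u v : List A) → 1 ≤ n → length u + length v ≤ length (u ^ n ++ v)
  length-^++ {suc n} u v _ =
    subst (length u + length v ≤_) length-eq (+-monoʳ-≤ (length u) (m≤n+m (length v) (length (u ^ n))))
    where
      length-eq : length u + (length (u ^ n) + length v) ≡ length (u ^ suc n ++ v)
      length-eq = begin
        length u + (length (u ^ n) + length v) ≡⟨ cong (length u +_) (length-++ (u ^ n)) ⟨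
        length u + length (u ^ n ++ v)         ≡⟨ length-++ u ⟨
        length (u ++ u ^ n ++ v)               ≡⟨ cong length (++-assoc u (u ^ n) v) ⟨
        length (u ^ suc n ++ v)                ∎

  prefix-^++ : ∀ {n} (u v : List A) → 1 ≤ n → Prefix u (u ^ n ++ v)
  prefix-^++ {suc n} u v _ = u ^ n ++ v , sym (++-assoc u (u ^ n) v)

  prefix-++ˡ : ∀ (w : List A) {u v} → Prefix u v → Prefix (w ++ u) (w ++ v)
  prefix-++ˡ w {u} (r , refl) = r , ++-assoc w u r

  ++-prefix-^++ : ∀ {n u v} → Prefix v u → 1 ≤ n → Prefix (u ++ v) (u ^ n ++ v)
  ++-prefix-^++ {suc n} {u} {v} v≼u _ =
    subst (Prefix (u ++ v)) (sym (++-assoc u (u ^ n) v)) (prefix-++ˡ u (v≼u^n++v n))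
    where
      v≼u^n++v : ∀ n → Prefix v (u ^ n ++ v)
      v≼u^n++v zero = [] , ++-identityʳ v
      v≼u^n++v (suc n) = prefix-trans v≼u (prefix-^++ {suc n} u v (s≤s z≤n))

  Mirrors-prefix-suc : ∀ {c u} → Mirrors c u → ∀ n → Prefix (u ^ n ++ c) (u ^ suc n ++ c)
  Mirrors-prefix-suc {c} {u} (mirrors slide) n = reverse u , (begin
    (u ^ n ++ c) ++ reverse u  ≡⟨ ++-assoc (u ^ n) c (reverse u) ⟩
    u ^ n ++ (c ++ reverse u)  ≡⟨ cong (u ^ n ++_) slide ⟨
    u ^ n ++ (u ++ c)          ≡⟨ ^-suc-++ u n c ⟨
    u ^ suc n ++ c             ∎)

  Mirrors-prefix-≤′ : ∀ {c u t n} → Mirrors c u → t ≤′ n → Prefix (u ^ t ++ c) (u ^ n ++ c)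
  Mirrors-prefix-≤′ _ ≤′-refl = [] , ++-identityʳ _
  Mirrors-prefix-≤′ c-mirrors-u (≤′-step {n} t≤′n) =
    prefix-trans (Mirrors-prefix-≤′ c-mirrors-u t≤′n) (Mirrors-prefix-suc c-mirrors-u n)

module CentralWords {A : Set} (a b : A) (s : ℕ → ℕ) where
  open Sturm a b s
  open Words

  C : ℕ → List A
  C zero = (b ∷ []) ^ (s 1 ∸ 1)
  C (suc k) = m (suc k) ^ s (suc (suc k)) ++ C k

  record Central (k : ℕ) : Set where
    field
      x y : A
      m-suc-m : m (suc k) ++ m k ≡ C k ++ x ∷ y ∷ []
      m-m-suc : m k ++ m (suc k) ≡ C k ++ y ∷ x ∷ []
      palindrome : Palindrome (C k)
      mirrors-m-suc : Mirrors (C k) (m (suc k))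
      mirrors-m : Mirrors (C k) (m k)

  central : ∀ k → Central k
  central zero = record
    { x = a
    ; y = b
    ; m-suc-m = ++-assoc c (a ∷ []) (b ∷ [])
    ; m-m-suc = trans (cong (_∷ʳ a) (sym (^-comm (b ∷ []) n))) (++-assoc c (b ∷ []) (a ∷ []))
    ; palindrome = c-palindrome
    ; mirrors-m-suc = Mirrors-∷ʳ c-palindrome a
    ; mirrors-m = mirrors (sym (^-comm (b ∷ []) n))
    }
    where
      n = s 1 ∸ 1
      c = (b ∷ []) ^ n
      c-palindrome : Palindrome c
      c-palindrome = reverse-^ (b ∷ []) n
  central (suc k) = record
    { x = y
    ; y = x
    ; m-suc-m = begin
        (p ++ v) ++ u             ≡⟨ ++-assoc p v u ⟩
        p ++ (v ++ u)             ≡⟨ cong (p ++_) m-m-suc ⟩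
        p ++ (C k ++ y ∷ x ∷ [])  ≡⟨ ++-assoc p (C k) _ ⟨
        (p ++ C k) ++ y ∷ x ∷ []  ∎
    ; m-m-suc = begin
        u ++ (p ++ v)             ≡⟨ ++-assoc u p v ⟨
        u ^ suc n ++ v            ≡⟨ ^-suc-++ u n v ⟩
        p ++ (u ++ v)             ≡⟨ cong (p ++_) m-suc-m ⟩
        p ++ (C k ++ x ∷ y ∷ [])  ≡⟨ ++-assoc p (C k) _ ⟨
        (p ++ C k) ++ x ∷ y ∷ []  ∎
    ; palindrome = palindrome-++ palindrome (Mirrors-^ mirrors-m-suc n)
    ; mirrors-m-suc = Mirrors-++ (Mirrors-^ mirrors-m-suc n) mirrors-m
    ; mirrors-m = Mirrors-^++ mirrors-m-suc n
    }
    where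
      open Central (central k)
      u = m (suc k)
      v = m k
      n = s (suc (suc k))
      p = u ^ n

  w : ℕ → ℕ → List A
  w k t = (m k ^ t ++ m (k ∸ 1)) ′

  w-suc-suc : ∀ k t → w (suc k) (suc t) ≡ m (suc k) ^ t ++ C k
  w-suc-suc k t = begin
    (u ^ suc t ++ m k) ′               ≡⟨ cong _′ (^-suc-++ u t (m k)) ⟩
    (u ^ t ++ (u ++ m k)) ′            ≡⟨ cong (λ z → (u ^ t ++ z) ′) m-suc-m ⟩
    (u ^ t ++ (C k ++ x ∷ y ∷ [])) ′   ≡⟨ cong _′ (++-assoc (u ^ t) (C k) _) ⟨
    ((u ^ t ++ C k) ++ x ∷ y ∷ []) ′   ≡⟨ ′-++-two (u ^ t ++ C k) x y ⟩
    u ^ t ++ C k                       ∎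
    where
      open Central (central k)
      u = m (suc k)

  w-palindrome : ∀ k t → 1 ≤ k → 1 ≤ t → Palindrome (w k t)
  w-palindrome (suc k) (suc t) _ _ =
    subst Palindrome (sym (w-suc-suc k t)) (palindrome-++ palindrome (Mirrors-^ mirrors-m-suc t))
    where open Central (central k)

  w-prefix-w-suc : ∀ k t → 1 ≤ k → 1 ≤ t → Prefix (w k t) (w k (suc t))
  w-prefix-w-suc (suc k) (suc t) _ _ =
    subst₂ Prefix (sym (w-suc-suc k t)) (sym (w-suc-suc k (suc t))) (Mirrors-prefix-suc mirrors-m-suc t)
    where open Central (central k)

  w-prefix-C : ∀ k t → 1 ≤ t → t ≤ s (suc (suc k)) → Prefix (w (suc k) t) (C (suc k))
  w-prefix-C k (suc t) _ t<s =
    subst (λ u → Prefix u (C (suc k))) (sym (w-suc-suc k t)) (Mirrors-prefix-≤′ mirrors-m-suc (≤⇒≤′ (<⇒≤ t<s)))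
    where open Central (central k)

  C≡w : ∀ k → C (suc k) ≡ w (suc (suc k)) 1
  C≡w k = sym (w-suc-suc (suc k) 0)

  C-prefix-m-suc-m : ∀ k → Prefix (C k) (m (suc k) ++ m k)
  C-prefix-m-suc-m k = x ∷ y ∷ [] , sym m-suc-m
    where open Central (central k)

  nth-++ : ∀ (u v : List A) n → n < length u → nth (u ++ v) n ≡ nth u n
  nth-++ (x ∷ u) v zero _ = refl
  nth-++ (x ∷ u) v (suc n) (s≤s n<∣u∣) = nth-++ u v n n<∣u∣

  nth-prefix : ∀ {u v : List A} → Prefix u v → ∀ {n} → n < length u → nth v n ≡ nth u n
  nth-prefix {u} (r , refl) = nth-++ u r _

  lookup≡nth : ∀ (u : List A) (i : Fin (length u)) → lookup u i ≡ nth u (toℕ i)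
  lookup≡nth (x ∷ u) fzero = refl
  lookup≡nth (x ∷ u) (fsuc i) = lookup≡nth u i

  module _ (s-pos : ∀ k → 1 ≤ k → 1 ≤ s k) where

    m-prefix-m-suc : ∀ k → Prefix (m (suc k)) (m (suc (suc k)))
    m-prefix-m-suc k = prefix-^++ (m (suc k)) (m k) (s-pos _ (s≤s z≤n))

    m-prefix-≤′ : ∀ {j n} → j ≤′ n → Prefix (m (suc j)) (m (suc n))
    m-prefix-≤′ ≤′-refl = [] , ++-identityʳ _
    m-prefix-≤′ (≤′-step {n} j≤′n) = prefix-trans (m-prefix-≤′ j≤′n) (m-prefix-m-suc n)

    C-prefix-m : ∀ k → Prefix (C (suc k)) (m (suc (suc (suc k))))
    C-prefix-m k =
      prefix-trans (C-prefix-m-suc-m (suc k)) (++-prefix-^++ (m-prefix-m-suc k) (s-pos _ (s≤s z≤n)))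

    mutual
      length-m : ∀ n → n < length (m (suc n))
      length-m zero = subst (1 ≤_) (sym (length-++ ((b ∷ []) ^ (s 1 ∸ 1)))) (m≤n+m 1 _)
      length-m (suc n) = ≤-trans
        (subst (_≤ length (m (suc n)) + length (m n)) (+-comm (suc n) 1) (+-mono-≤ (length-m n) (m-nonempty n)))
        (length-^++ (m (suc n)) (m n) (s-pos _ (s≤s z≤n)))

      m-nonempty : ∀ n → 1 ≤ length (m n)
      m-nonempty zero = s≤s z≤n
      m-nonempty (suc n) = ≤-trans (s≤s z≤n) (length-m n)

    nth-m≡mφ : ∀ j n → n < length (m (suc j)) → nth (m (suc j)) n ≡ mφ n
    nth-m≡mφ j n n<∣m∣ = trans
      (sym (nth-prefix (m-prefix-≤′ (≤⇒≤′ (m≤m+n j n))) n<∣m∣))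
      (nth-prefix (m-prefix-≤′ (≤⇒≤′ (m≤n+m n j))) (length-m n))

    prefix-m⇒PrefixInf : ∀ {u} j → Prefix u (m (suc j)) → PrefixInf u mφ
    prefix-m⇒PrefixInf {u} j u≼m i = begin
      lookup u i               ≡⟨ lookup≡nth u i ⟩
      nth u (toℕ i)            ≡⟨ nth-prefix u≼m (toℕ<n i) ⟨
      nth (m (suc j)) (toℕ i)  ≡⟨ nth-m≡mφ j (toℕ i) (≤-trans (toℕ<n i) (prefix-length u≼m)) ⟩
      mφ (toℕ i)               ∎

-- The argument never uses a ≢ b.
lemma5p3 : {A : Set} (a b : A) → a ≢ b → (s : ℕ → ℕ) → (∀ k → 1 ≤ k → 1 ≤ s k) →
    let open Sturm a b s in
    let w = λ k t → (pow (m k) t ++ m (k ∸ 1)) ′ in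
    ((k t : ℕ) → 1 ≤ k → 1 ≤ t → t ≤ s (suc k) →
        PrefixInf (w k t) mφ × Palindrome (w k t))
    × ((k t : ℕ) → 1 ≤ k → 1 ≤ t → t < s (suc k) → Prefix (w k t) (w k (suc t)))
    × ((k : ℕ) → 1 ≤ k → Prefix (w k (s (suc k))) (w (suc k) 1))
lemma5p3 a b _ s s-pos =
  (λ k t 1≤k 1≤t t≤s → prefix-mφ k t 1≤k 1≤t t≤s , w-palindrome k t 1≤k 1≤t)
  , (λ k t 1≤k 1≤t _ → w-prefix-w-suc k t 1≤k 1≤t)
  , prefix-next
  where
    open Sturm a b s
    open Words
    open CentralWords a b s

    prefix-mφ : ∀ k t → 1 ≤ k → 1 ≤ t → t ≤ s (suc k) → PrefixInf (w k t) mφ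
    prefix-mφ (suc k) t _ 1≤t t≤s =
      prefix-m⇒PrefixInf s-pos (suc (suc k)) (prefix-trans (w-prefix-C k t 1≤t t≤s) (C-prefix-m s-pos k))

    prefix-next : ∀ k → 1 ≤ k → Prefix (w k (s (suc k))) (w (suc k) 1)
    prefix-next (suc k) _ = subst (Prefix _) (C≡w k) (w-prefix-C k _ (s-pos _ (s≤s z≤n)) ≤-refl)
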